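{- Let $n\ge1$ and $T\in\mathrm{zRTT}_0(n)$, and let $\phi(T)=(a,b)$. Then for every $1\le i\le n-1$ we have $a_i<a_{i+1}$ or $b_i<b_{i+1}$; in particular $\phi$ is a map $\mathrm{zRTT}_0(n)\to\mathrm{zLD}^2(n)$. Moreover $\alpha(\phi(T))=\alpha(T)$ and $\beta(\phi(T))=\mathrm{rev}(\beta(T))$.
   Context: A tiered rooted tree on $n+1$ vertices is a tree $T$ with vertex set $V$, $|V|=n+1$, a root $r\in V$, and functions $w$ (label) and $\mathrm{lv}$ (level) on $V$ with $w(r)=\mathrm{lv}(r)=0$ and $w(v),\mathrm{lv}(v)\in\mathbb{Z}_{\ge1}$ for $v\ne r$, such that: for every edge $\{u,v\}$ with $u,v\ne r$, $w(u)\neq w(v)$, $\mathrm{lv}(u)\ne\mathrm{lv}(v)$ and $w(u)<w(v)\iff\mathrm{lv}(u)<\mathrm{lv}(v)$; and distinct vertices with the same parent have different pairs $(w,\mathrm{lv})$. Trees are considered up to isomorphism preserving root, labels and levels. The parent $p(v)$ of $v\ne r$ is its neighbour closer to $r$; $u$ is a descendant of $v$ if $v=p^k(u)$ for some $k>0$. Vertices $u,v$ are compatible, $u\bowtie v$, if ($\mathrm{lv}(u)<\mathrm{lv}(v)$ and $w(u)<w(v)$) or ($\mathrm{lv}(u)>\mathrm{lv}(v)$ and $w(u)>w(v)$). A pair $(u,v)$ of non-root vertices is an inversion if $v$ is a descendant of $u$, $v\bowtie p(u)$, and either $w(v)<w(u)$ or ($w(v)=w(u)$ and $\mathrm{lv}(v)>\mathrm{lv}(u)$).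 $\mathrm{zRTT}_0(n)$ is the set of tiered rooted trees on $n+1$ vertices with no inversions. $\alpha(T)$ (resp. $\beta(T)$) is the weak composition whose $i$-th entry is the number of non-root vertices with label (resp. level) $i$. With $L$ and $l$ the maximum and minimum level over non-root vertices, the reverse level is $\mathrm{lv}'(v)=L+l-\mathrm{lv}(v)$. The map $\phi$: explore $T$ depth-first (preorder) from the root, where the children of a vertex are visited in decreasing order of label, and among children with equal label in increasing order of level. Let $v_0=r,v_1,\dots,v_n$ be the vertices in the order visited, and set $\phi(T)=(a,b)$ with $a_i=w(v_{n+1-i})$ and $b_i=\mathrm{lv}'(v_{n+1-i})$ for $i\in[n]$. $\mathrm{zLD}^2(n)$ is the set of pairs of sequences $(a,b)$ of positive integers of length $n$ with $a_i<a_{i+1}$ or $b_i<b_{i+1}$ for each $1\le i\le n-1$ (identified with the $2$-labelled Dyck paths of size $n$ and area $0$); $\alpha(a,b)_i=\#\{j:a_j=i\}$, $\beta(a,b)_i=\#\{j:b_j=i\}$. For a weak composition $\beta$ with nonzero entries, with $s$ (resp. $m$) the smallest (resp. largest) index of a nonzero entry, $\mathrm{rev}(\beta)_i=\beta_{s+m-i}$ for $s\le i\le m$ and $0$ otherwise. -}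

module Defs where

open import Data.Nat using (ℕ; zero; suc; _+_; _∸_; _≤_; _<_; _⊔_; _⊓_; _<ᵇ_; _≡ᵇ_; _≤ᵇ_)
open import Data.Nat.Properties using (_≟_)
open import Data.List using (List; []; _∷_; _++_; length; map; concat; foldr; reverse; filter)
open import Data.List.Relation.Unary.All using (All)
open import Data.List.Relation.Unary.AllPairs using (AllPairs)
open import Data.Product using (_×_; _,_; proj₁; proj₂)
open import Data.Sum using (_⊎_)
open import Data.Bool using (Bool; if_then_else_; _∧_; _∨_)
open import Data.Unit using (⊤)
open import Relation.Nullary using (¬_)
open import Relation.Binary.PropositionalEquality using (_≡_; _≢_)

-- A rooted tree is represented by the forest of the
-- children of the root r (the root has w = lv = 0 implicitly).
-- Ordering of children in the list is irrelevant to everything below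
-- (phi sorts children), so quantifying over representatives is the same
-- as quantifying over isomorphism classes.

data Tree : Set where
  node : (w lv : ℕ) → List Tree → Tree

RTree : Set
RTree = List Tree

Vtx : Set
Vtx = ℕ × ℕ

rootV : Tree → Vtx
rootV (node w l _) = (w , l)

rootVtx : Vtx
rootVtx = (0 , 0)

mutual
  verts : Tree → List Vtx
  verts (node w l ts) = (w , l) ∷ vertsF ts

  vertsF : List Tree → List Vtx
  vertsF [] = []
  vertsF (t ∷ ts) = verts t ++ vertsF ts

EdgeOK : Vtx → Vtx → Set
EdgeOK (w , l) (w' , l') =
  w ≢ w' × l ≢ l' × ((w < w' → l < l') × (l < l' → w < w'))

mutual
  TieredT : Tree → Set
  TieredT (node w l ts) =
    1 ≤ w × 1 ≤ l
    × All (λ t → EdgeOK (w , l) (rootV t)) ts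
    × AllPairs (λ t u → rootV t ≢ rootV u) ts
    × TieredF ts

  TieredF : List Tree → Set
  TieredF [] = ⊤
  TieredF (t ∷ ts) = TieredT t × TieredF ts

Tiered : RTree → Set
Tiered F = AllPairs (λ t u → rootV t ≢ rootV u) F × TieredF F

_⋈_ : Vtx → Vtx → Set
(w , l) ⋈ (w' , l') = (l < l' × w < w') ⊎ (l' < l × w' < w)

-- (u , v) is an inversion, given p = p(u) and v a descendant of u
InvCond : Vtx → Vtx → Vtx → Set
InvCond p (wu , lu) (wv , lv) =
  (wv , lv) ⋈ p × (wv < wu ⊎ (wv ≡ wu × lu < lv))

mutual
  NoInvT : Vtx → Tree → Set
  NoInvT p (node w l ts) =
    All (λ v → ¬ InvCond p (w , l) v) (vertsF ts) × NoInvF (w , l) ts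

  NoInvF : Vtx → List Tree → Set
  NoInvF p [] = ⊤
  NoInvF p (t ∷ ts) = NoInvT p t × NoInvF p ts

-- zRTT_0(n): tiered rooted trees on n+1 vertices with no inversions
zRTT0 : ℕ → RTree → Set
zRTT0 n F = length (vertsF F) ≡ n × Tiered F × NoInvF rootVtx F

before : Vtx → Vtx → Bool
before (w , l) (w' , l') = (w' <ᵇ w) ∨ ((w ≡ᵇ w') ∧ (l <ᵇ l'))

insertP : Vtx × List Vtx → List (Vtx × List Vtx) → List (Vtx × List Vtx)
insertP x [] = x ∷ []
insertP x (y ∷ ys) =
  if before (proj₁ x) (proj₁ y) then x ∷ y ∷ ys else y ∷ insertP x ys

sortP : List (Vtx × List Vtx) → List (Vtx × List Vtx)
sortP = foldr insertP []

mutual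
  pre : Tree → List Vtx
  pre (node w l ts) = (w , l) ∷ concat (map proj₂ (sortP (preF ts)))

  preF : List Tree → List (Vtx × List Vtx)
  preF [] = []
  preF (t ∷ ts) = (rootV t , pre t) ∷ preF ts

-- v_1, ..., v_n (root v_0 omitted)
order : RTree → List Vtx
order F = concat (map proj₂ (sortP (preF F)))

maxLv : List Vtx → ℕ
maxLv vs = foldr (λ v m → proj₂ v ⊔ m) 0 vs

minLv : List Vtx → ℕ
minLv vs = foldr (λ v m → proj₂ v ⊓ m) (maxLv vs) vs

-- phi(T) = (a , b), a_i = w(v_{n+1-i}), b_i = lv'(v_{n+1-i})
phi : RTree → List ℕ × List ℕ
phi F = map proj₁ vs , map (λ v → (L + l) ∸ proj₂ v) vs
  where
    vs = reverse (order F)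
    L  = maxLv (order F)
    l  = minLv (order F)

-- 1-indexed entry of a sequence (0 when out of range)
ith : List ℕ → ℕ → ℕ
ith [] _ = 0
ith (x ∷ xs) zero = 0
ith (x ∷ xs) (suc zero) = x
ith (x ∷ xs) (suc (suc k)) = ith xs (suc k)

Ascent : List ℕ × List ℕ → ℕ → Set
Ascent (a , b) i = ith a i < ith a (suc i) ⊎ ith b i < ith b (suc i)

zLD2 : ℕ → List ℕ × List ℕ → Set
zLD2 n (a , b) =
  length a ≡ n × length b ≡ n × All (1 ≤_) a × All (1 ≤_) b
  × (∀ i → 1 ≤ i → i ≤ n ∸ 1 → Ascent (a , b) i)

-- weak compositions as functions ℕ → ℕ (entry i for i ≥ 1)
count : ℕ → List ℕ → ℕ
count i xs = length (filter (_≟ i) xs)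

alphaT : RTree → ℕ → ℕ
alphaT F i = count i (map proj₁ (vertsF F))

betaT : RTree → ℕ → ℕ
betaT F i = count i (map proj₂ (vertsF F))

alphaS : List ℕ × List ℕ → ℕ → ℕ
alphaS (a , b) i = count i a

betaS : List ℕ × List ℕ → ℕ → ℕ
betaS (a , b) i = count i b

IsMinSupp : (ℕ → ℕ) → ℕ → Set
IsMinSupp β s = 1 ≤ s × β s ≢ 0 × (∀ i → 1 ≤ i → i < s → β i ≡ 0)

IsMaxSupp : (ℕ → ℕ) → ℕ → Set
IsMaxSupp β m = β m ≢ 0 × (∀ i → m < i → β i ≡ 0)

revWith : ℕ → ℕ → (ℕ → ℕ) → ℕ → ℕ
revWith s m β i = if (s ≤ᵇ i) ∧ (i ≤ᵇ m) then β ((s + m) ∸ i) else 0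

{-# OPTIONS --safe #-}
module Submission where

-- φ lists the preorder v₁ … vₙ backwards and sends each level k to L + l ∸ k, so it
-- preserves α and reflects the multiset of levels inside [l, L], which gives rev(β).
-- The ascent condition of φ(T) says that consecutive vertices x, y of the preorder
-- satisfy x ⇝ y, i.e. w y < w x or lv x < lv y. If y is the first child of x this is
-- the tiered edge condition. Otherwise y is the next sibling, under a parent p, of some
-- u with u ≺ y in the sibling order, and x is u (then x ⇝ y is immediate) or lies below u.
-- Write x ⊑ y for w y ≤ w x and lv x ≤ lv y, and x ⊏ y if moreover x ≠ y; then x ⊏ y
-- implies x ≺ y, and an inversion (u, v) means exactly v ⋈ p and u ≺ v. The key fact
-- (⊏-parent) is that x ⋈ p, x ⊑ v and not v ⋈ p force p ⊏ v. By induction from the root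
-- it shows that p ⊏ v holds for no descendant v of any vertex p. Now if x ⇝ y failed,
-- then y ⊑ x, so u ≺ x; as (u, x) is no inversion, x ⋈ p fails, and the key fact for y
-- gives p ⊏ x.

open import Defs
open import Data.Nat using (ℕ; suc; _+_; _∸_; _≤_; _<_; _>_; _⊔_; _⊓_; _≤ᵇ_; s≤s; z≤n)
open import Data.Nat.Properties
open import Data.Bool using (true; false)
open import Data.List using (List; []; _∷_; _++_; length; map; concat; foldr; reverse; reverseAcc)
open import Data.List.Properties
  using (filter-accept; filter-reject; filter-none; filter-some; foldr-map; foldr-forcesᵇ;
         length-map; map-∘; ++-identityʳ)
open import Data.List.Membership.Propositional using (_∈_)
open import Data.List.Membership.Propositional.Properties using (foldr-selective)
open import Data.List.Relation.Unary.All as All using (All; []; _∷_)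
import Data.List.Relation.Unary.All.Properties as Allₚ
open import Data.List.Relation.Unary.Any as Any using (here; there)
open import Data.List.Relation.Unary.AllPairs using (AllPairs; []; _∷_)
open import Data.List.Relation.Unary.Linked as Linked using (Linked; []; [-]; _∷_)
open import Data.List.Relation.Unary.Linked.Properties using (AllPairs⇒Linked)
import Data.List.Relation.Binary.Permutation.Propositional as ↭
open ↭ using (_↭_; ↭-refl; ↭-sym; ↭-trans)
import Data.List.Relation.Binary.Permutation.Propositional.Properties as ↭ₚ
open ↭ₚ using (All-resp-↭; ∈-resp-↭; ↭-length; ↭-reverse; filter-↭)
open import Data.Product using (_×_; _,_; proj₁; proj₂; uncurry)
import Data.Product as Product
open import Data.Product.Relation.Binary.Lex.Strict using (×-Lex; ×-decidable; ×-transitive; ×-compare)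
open import Data.Product.Relation.Binary.Pointwise.NonDependent using (≡×≡⇒≡)
open import Data.Sum using (_⊎_; inj₁; inj₂)
import Data.Sum as Sum
open import Function using (_∘_; _on_; flip)
open import Level using (Level)
open import Relation.Binary using (Rel; Transitive; Decidable; tri<; tri≈; tri>)
import Relation.Binary.Construct.Flip.EqAndOrd as Flip
open import Relation.Binary.PropositionalEquality
  using (_≡_; _≢_; refl; sym; trans; cong; subst; isEquivalence; resp₂; module ≡-Reasoning)
open import Relation.Nullary using (¬_; yes; no; proof; contradiction)
open import Relation.Nullary.Reflects using (Reflects; ofʸ; ofⁿ)

private
  variable
    a ℓ : Level
    A : Set a
    x y z u v c : Vtx
    i k s m : ℕ
    ks : List ℕ

concat-↭ : {xss yss : List (List A)} → xss ↭ yss → concat xss ↭ concat yss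
concat-↭ ↭.refl           = ↭-refl
concat-↭ (↭.prep xs p)    = ↭ₚ.++⁺ˡ xs (concat-↭ p)
concat-↭ (↭.swap xs ys p) = ↭-trans (↭ₚ.shifts xs ys) (↭ₚ.++⁺ˡ ys (↭ₚ.++⁺ˡ xs (concat-↭ p)))
concat-↭ (↭.trans p q)    = ↭-trans (concat-↭ p) (concat-↭ q)

++-∷⁺ : {R : Rel A ℓ} {xs ys : List A} {y : A} →
        Linked R xs → All (λ x → R x y) xs → Linked R (y ∷ ys) → Linked R (xs ++ y ∷ ys)
++-∷⁺ []       []       Ryys = Ryys
++-∷⁺ [-]      (r ∷ []) Ryys = r ∷ Ryys
++-∷⁺ (r ∷ rs) (_ ∷ Rs) Ryys = r ∷ ++-∷⁺ rs Rs Ryys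

reverseAcc⁺ : {R : Rel A ℓ} {x : A} {acc : List A} → ∀ xs →
              Linked (flip R) (x ∷ acc) → Linked R (x ∷ xs) →
              Linked (flip R) (reverseAcc (x ∷ acc) xs)
reverseAcc⁺ []       racc _        = racc
reverseAcc⁺ (_ ∷ xs) racc (r ∷ rs) = reverseAcc⁺ xs (r ∷ racc) rs

reverse⁺ : {R : Rel A ℓ} → ∀ xs → Linked R xs → Linked (flip R) (reverse xs)
reverse⁺ []       _  = []
reverse⁺ (_ ∷ xs) rs = reverseAcc⁺ xs [-] rs

map-All : {P : A → Set} {R S : Rel A ℓ} {xs : List A} →
          (∀ {a b} → P a → R a b → S a b) → All P xs → Linked R xs → Linked S xs
map-All f _        []       = []
map-All f _        [-]      = [-]
map-All f (p ∷ ps) (r ∷ rs) = f p r ∷ map-All f ps rs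

Linked⇒Ascent : (f g : A → ℕ) (xs : List A) → Linked (λ a b → f a < f b ⊎ g a < g b) xs →
                ∀ i → 1 ≤ i → i < length xs → Ascent (map f xs , map g xs) i
Linked⇒Ascent f g []               _        (suc _)       _ ()
Linked⇒Ascent f g (_ ∷ [])         _        (suc _)       _ (s≤s ())
Linked⇒Ascent f g (_ ∷ _ ∷ _)      (r ∷ _)  1             _ _         = r
Linked⇒Ascent f g (_ ∷ xs@(_ ∷ _)) (_ ∷ rs) (suc (suc i)) _ (s≤s i<n) =
  Linked⇒Ascent f g xs rs (suc i) (s≤s z≤n) i<n

count-↭ : {xs ys : List ℕ} → ∀ i → xs ↭ ys → count i xs ≡ count i ys
count-↭ i p = ↭-length (filter-↭ (_≟ i) p)

count-accept : k ≡ i → count i (k ∷ ks) ≡ suc (count i ks)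
count-accept k≡i = cong length (filter-accept (_≟ _) k≡i)

count-reject : k ≢ i → count i (k ∷ ks) ≡ count i ks
count-reject k≢i = cong length (filter-reject (_≟ _) k≢i)

count-none : All (_≢ i) ks → count i ks ≡ 0
count-none ks≢i = cong length (filter-none (_≟ _) ks≢i)

∈⇒count≢0 : i ∈ ks → count i ks ≢ 0
∈⇒count≢0 i∈ks = m<n⇒n≢0 (filter-some (_≟ _) (Any.map sym i∈ks))

count≢0⇒∈ : count i ks ≢ 0 → i ∈ ks
count≢0⇒∈ {ks = []}     c = contradiction refl c
count≢0⇒∈ {i} {k ∷ ks} c with k ≟ i
... | yes k≡i = here (sym k≡i)
... | no k≢i  = there (count≢0⇒∈ (c ∘ trans (count-reject k≢i)))

count-map-injective : ∀ (f : ℕ → ℕ) ks → All (λ k → f k ≡ f i → k ≡ i) ks →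
                      count (f i) (map f ks) ≡ count i ks
count-map-injective f []       []           = refl
count-map-injective {i} f (k ∷ ks) (inj ∷ injs) with k ≟ i
... | yes k≡i = begin
  count (f i) (f k ∷ map f ks) ≡⟨ count-accept (cong f k≡i) ⟩
  suc (count (f i) (map f ks)) ≡⟨ cong suc (count-map-injective f ks injs) ⟩
  suc (count i ks)             ≡⟨ count-accept k≡i ⟨
  count i (k ∷ ks)             ∎
  where open ≡-Reasoning
... | no k≢i = begin
  count (f i) (f k ∷ map f ks) ≡⟨ count-reject (k≢i ∘ inj) ⟩
  count (f i) (map f ks)       ≡⟨ count-map-injective f ks injs ⟩
  count i ks                   ≡⟨ count-reject k≢i ⟨
  count i (k ∷ ks)             ∎
  where open ≡-Reasoning

foldr-⊔-upper : ∀ b ks → All (_≤ foldr _⊔_ b ks) ks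
foldr-⊔-upper b ks =
  foldr-forcesᵇ (λ m n m⊔n≤ → m⊔n≤o⇒m≤o m n m⊔n≤ , m⊔n≤o⇒n≤o m n m⊔n≤) b ks ≤-refl

foldr-⊓-lower : ∀ b ks → All (foldr _⊓_ b ks ≤_) ks
foldr-⊓-lower b ks =
  foldr-forcesᵇ (λ m n ≤m⊓n → m≤n⊓o⇒m≤n m n ≤m⊓n , m≤n⊓o⇒m≤o m n ≤m⊓n) b ks ≤-refl

foldr-⊔-∈ : k ∈ ks → foldr _⊔_ 0 ks ∈ ks
foldr-⊔-∈ {ks = n ∷ ns} _ with foldr-selective ⊔-sel 0 (n ∷ ns)
... | inj₂ max∈  = max∈
... | inj₁ max≡0 = here (trans max≡0 (sym (n≤0⇒n≡0 (subst (n ≤_) max≡0 (m≤m⊔n n _)))))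

foldr-⊓-∈ : k ∈ ks → foldr _⊓_ k ks ∈ ks
foldr-⊓-∈ {ks = ks} k∈ks with foldr-selective ⊓-sel _ ks
... | inj₁ min≡k = subst (_∈ ks) (sym min≡k) k∈ks
... | inj₂ min∈  = min∈

reflect : ℕ → ℕ → ℕ → ℕ
reflect l L k = (L + l) ∸ k

InRange : ℕ → ℕ → ℕ → Set
InRange l L k = l ≤ k × k ≤ L

reflect-inRange : ∀ {l L k} → InRange l L k → InRange l L (reflect l L k)
reflect-inRange {l} {L} {k} (l≤k , k≤L) =
  subst (_≤ reflect l L k) (m+n∸m≡n L l) (∸-monoʳ-≤ (L + l) k≤L) ,
  subst (reflect l L k ≤_) (m+n∸n≡m L l) (∸-monoʳ-≤ (L + l) l≤k)

count-reflect : ∀ {l L i} ks → All (InRange l L) ks →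
                count i (map (reflect l L) ks) ≡ revWith l L (λ j → count j ks) i
count-reflect {l} {L} {i} ks bounds with l ≤ᵇ i | ≤ᵇ-reflects-≤ l i | i ≤ᵇ L | ≤ᵇ-reflects-≤ i L
... | true | ofʸ _ | true | ofʸ i≤L = begin
  count i (map r ks)         ≡⟨ cong (λ j → count j (map r ks)) (m∸[m∸n]≡n (≤-trans i≤L (m≤m+n L l))) ⟨
  count (r (r i)) (map r ks) ≡⟨ count-map-injective r ks (All.map r-injective bounds) ⟩
  count (r i) ks             ≡⟨ cong (λ n → count (n ∸ i) ks) (+-comm L l) ⟩
  count ((l + L) ∸ i) ks     ∎
  where
  open ≡-Reasoning
  r = reflect l L
  r-injective : ∀ {k} → InRange l L k → r k ≡ r (r i) → k ≡ r i
  r-injective (_ , k≤L) = ∸-cancelˡ-≡ (≤-trans k≤L (m≤m+n L l)) (m∸n≤m (L + l) i)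
... | false | ofⁿ l≰i | _ | _ =
  count-none (Allₚ.map⁺ (All.map (λ b r≡i → l≰i (subst (l ≤_) r≡i (proj₁ (reflect-inRange b)))) bounds))
... | true | _ | false | ofⁿ i≰L =
  count-none (Allₚ.map⁺ (All.map (λ b r≡i → i≰L (subst (_≤ L) r≡i (proj₂ (reflect-inRange b)))) bounds))

minSupp≡least : ∀ {l} → 1 ≤ l → l ∈ ks → All (l ≤_) ks → IsMinSupp (λ j → count j ks) s → s ≡ l
minSupp≡least 1≤l l∈ks l≤ks (_ , count-s≢0 , below-s) =
  ≤-antisym (≮⇒≥ (λ l<s → ∈⇒count≢0 l∈ks (below-s _ 1≤l l<s))) (All.lookup l≤ks (count≢0⇒∈ count-s≢0))

maxSupp≡greatest : ∀ {L} → L ∈ ks → All (_≤ L) ks → IsMaxSupp (λ j → count j ks) m → m ≡ L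
maxSupp≡greatest L∈ks ks≤L (count-m≢0 , above-m) =
  ≤-antisym (All.lookup ks≤L (count≢0⇒∈ count-m≢0)) (≮⇒≥ (λ m<L → ∈⇒count≢0 L∈ks (above-m _ m<L)))

-- Orders on vertices

w lv : Vtx → ℕ
w  = proj₁
lv = proj₂

_≺_ : Rel Vtx _
_≺_ = ×-Lex _≡_ _>_ _<_

_≺?_ : Decidable _≺_
_≺?_ = ×-decidable _≟_ (flip _<?_) _<?_

before-reflects : ∀ x y → Reflects (x ≺ y) (before x y)
before-reflects x y = proof (x ≺? y)

≺-trans : Transitive _≺_
≺-trans = ×-transitive {_≈₁_ = _≡_} {_<₁_ = _>_} {_<₂_ = _<_}
            isEquivalence (resp₂ _>_) (flip <-trans) <-trans

≺-flip : x ≢ y → ¬ x ≺ y → y ≺ x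
≺-flip {x} {y} x≢y x⊀y with ×-compare sym (Flip.compare _<_ <-cmp) <-cmp x y
... | tri< x≺y _ _ = contradiction x≺y x⊀y
... | tri≈ _ x≈y _ = contradiction (≡×≡⇒≡ x≈y) x≢y
... | tri> _ _ y≺x = y≺x

_⊑_ : Rel Vtx _
x ⊑ y = w y ≤ w x × lv x ≤ lv y

_⊏_ : Rel Vtx _
x ⊏ y = x ⊑ y × x ≢ y

⊑⇒≼ : x ⊑ y → x ≺ y ⊎ x ≡ y
⊑⇒≼ (wy≤wx , lx≤ly) with m≤n⇒m<n∨m≡n wy≤wx | m≤n⇒m<n∨m≡n lx≤ly
... | inj₁ wy<wx | _          = inj₁ (inj₁ wy<wx)
... | inj₂ wy≡wx | inj₁ lx<ly = inj₁ (inj₂ (sym wy≡wx , lx<ly))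
... | inj₂ wy≡wx | inj₂ lx≡ly = inj₂ (≡×≡⇒≡ (sym wy≡wx , lx≡ly))

⊏⇒≺ : x ⊏ y → x ≺ y
⊏⇒≺ (x⊑y , x≢y) with ⊑⇒≼ x⊑y
... | inj₁ x≺y = x≺y
... | inj₂ x≡y = contradiction x≡y x≢y

≺-⊑-trans : x ≺ y → y ⊑ z → x ≺ z
≺-⊑-trans x≺y y⊑z with ⊑⇒≼ y⊑z
... | inj₁ y≺z  = ≺-trans x≺y y≺z
... | inj₂ refl = x≺y

_⇝_ : Rel Vtx _
x ⇝ y = w y < w x ⊎ lv x < lv y

⇝-or-⊑ : ∀ x y → x ⇝ y ⊎ y ⊑ x
⇝-or-⊑ x y with w y <? w x | lv x <? lv y
... | yes wy<wx | _         = inj₁ (inj₁ wy<wx)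
... | no _      | yes lx<ly = inj₁ (inj₂ lx<ly)
... | no wy≮wx  | no lx≮ly  = inj₂ (≮⇒≥ wy≮wx , ≮⇒≥ lx≮ly)

≺⇒⇝ : x ≺ y → x ⇝ y
≺⇒⇝ = Sum.map₂ proj₂

inversion : v ⋈ u → x ≺ v → InvCond u x v
inversion v⋈u x≺v = v⋈u , Sum.map₂ (Product.map₁ sym) x≺v

⊏-parent : x ⋈ u → x ⊑ v → ¬ v ⋈ u → u ⊏ v
⊏-parent (inj₁ (_ , wx<wu)) (wv≤wx , _) v⋈̸u =
  (<⇒≤ wv<wu , ≮⇒≥ (λ lv<lu → v⋈̸u (inj₁ (lv<lu , wv<wu)))) , λ u≡v → <-irrefl (cong w (sym u≡v)) wv<wu
  where wv<wu = ≤-<-trans wv≤wx wx<wu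
⊏-parent (inj₂ (lu<lx , _)) (_ , lx≤lv) v⋈̸u =
  (≮⇒≥ (λ wu<wv → v⋈̸u (inj₂ (lu<lv , wu<wv))) , <⇒≤ lu<lv) , λ u≡v → <-irrefl (cong lv u≡v) lu<lv
  where lu<lv = <-≤-trans lu<lx lx≤lv

¬⊏-child : x ⋈ u → ¬ InvCond u x v → ¬ u ⊏ v → ¬ x ⊏ v
¬⊏-child x⋈u ¬inv u⊏̸v x⊏v =
  u⊏̸v (⊏-parent x⋈u (proj₁ x⊏v) (λ v⋈u → ¬inv (inversion v⋈u (⊏⇒≺ x⊏v))))

⇝-later-sibling : z ⋈ u → x ≺ z → ¬ InvCond u x v → ¬ u ⊏ v → v ⇝ z
⇝-later-sibling {z = z} {v = v} z⋈u x≺z ¬inv u⊏̸v with ⇝-or-⊑ v z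
... | inj₁ v⇝z = v⇝z
... | inj₂ z⊑v =
  contradiction (⊏-parent z⋈u z⊑v (λ v⋈u → ¬inv (inversion v⋈u (≺-⊑-trans x≺z z⊑v)))) u⊏̸v

ChildEdge : Vtx → Vtx → Set
ChildEdge x c = x ⇝ c × c ⋈ x

edge⇒childEdge : EdgeOK x c → ChildEdge x c
edge⇒childEdge {x} {c} (w≢ , lv≢ , w<⇒lv< , lv<⇒w<) with <-cmp (w c) (w x) | <-cmp (lv c) (lv x)
... | tri< wc<wx _ _ | tri< lc<lx _ _ = inj₁ wc<wx , inj₁ (lc<lx , wc<wx)
... | tri< _ _ _     | tri≈ _ lc≡lx _ = contradiction (sym lc≡lx) lv≢
... | tri< wc<wx _ _ | tri> _ _ lx<lc = contradiction (lv<⇒w< lx<lc) (<-asym wc<wx)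
... | tri≈ _ wc≡wx _ | _              = contradiction (sym wc≡wx) w≢
... | tri> _ _ wx<wc | _              = inj₂ (w<⇒lv< wx<wc) , inj₂ (w<⇒lv< wx<wc , wx<wc)

-- Preorder

Entry : Set
Entry = Vtx × List Vtx

insertP-↭ : ∀ e es → insertP e es ↭ e ∷ es
insertP-↭ e []        = ↭-refl
insertP-↭ e (e′ ∷ es) with before (proj₁ e) (proj₁ e′)
... | true  = ↭-refl
... | false = ↭-trans (↭.prep e′ (insertP-↭ e es)) (↭.swap e′ e ↭-refl)

sortP-↭ : ∀ es → sortP es ↭ es
sortP-↭ []       = ↭-refl
sortP-↭ (e ∷ es) = ↭-trans (insertP-↭ e (sortP es)) (↭.prep e (sortP-↭ es))

insertP-sorted : ∀ e es → All ((_≢_ on proj₁) e) es → AllPairs (_≺_ on proj₁) es →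
                 AllPairs (_≺_ on proj₁) (insertP e es)
insertP-sorted e []        _              _                = [] ∷ []
insertP-sorted e (e′ ∷ es) (e≢e′ ∷ e≢es) (e′≺es ∷ sorted)
  with before (proj₁ e) (proj₁ e′) | before-reflects (proj₁ e) (proj₁ e′)
... | true  | ofʸ e≺e′ = (e≺e′ ∷ All.map (≺-trans e≺e′) e′≺es) ∷ e′≺es ∷ sorted
... | false | ofⁿ e⊀e′ =
  All-resp-↭ (↭-sym (insertP-↭ e es)) (≺-flip e≢e′ e⊀e′ ∷ e′≺es) ∷ insertP-sorted e es e≢es sorted

sortP-sorted : ∀ es → AllPairs (_≢_ on proj₁) es → AllPairs (_≺_ on proj₁) (sortP es)
sortP-sorted []       []                = []
sortP-sorted (e ∷ es) (e≢es ∷ distinct) =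
  insertP-sorted e (sortP es) (All-resp-↭ (↭-sym (sortP-↭ es)) e≢es) (sortP-sorted es distinct)

mutual
  pre-↭ : ∀ t → pre t ↭ verts t
  pre-↭ (node a b ts) = ↭.prep (a , b) (order-↭ ts)

  order-↭ : ∀ ts → order ts ↭ vertsF ts
  order-↭ ts = ↭-trans (concat-↭ (↭ₚ.map⁺ proj₂ (sortP-↭ (preF ts)))) (preF-↭ ts)

  preF-↭ : ∀ ts → concat (map proj₂ (preF ts)) ↭ vertsF ts
  preF-↭ []       = ↭-refl
  preF-↭ (t ∷ ts) = ↭ₚ.++⁺ (pre-↭ t) (preF-↭ ts)

preF-keys : {P : Vtx → Set} → ∀ ts → All (P ∘ rootV) ts → All (P ∘ proj₁) (preF ts)
preF-keys []       []       = []
preF-keys (t ∷ ts) (p ∷ ps) = p ∷ preF-keys ts ps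

preF-distinct : ∀ ts → AllPairs (_≢_ on rootV) ts → AllPairs (_≢_ on proj₁) (preF ts)
preF-distinct []       []       = []
preF-distinct (t ∷ ts) (d ∷ ds) = preF-keys ts d ∷ preF-distinct ts ds

-- Consecutive vertices of the preorder

Positive : Vtx → Set
Positive v = 1 ≤ w v × 1 ≤ lv v

mutual
  tree-positive : ∀ t → TieredT t → All Positive (verts t)
  tree-positive (node _ _ ts) (1≤w , 1≤lv , _ , _ , tiered) = (1≤w , 1≤lv) ∷ forest-positive ts tiered

  forest-positive : ∀ ts → TieredF ts → All Positive (vertsF ts)
  forest-positive []       _                  = []
  forest-positive (t ∷ ts) (tiered , tiereds) =
    Allₚ.++⁺ (tree-positive t tiered) (forest-positive ts tiereds)

root-childEdges : ∀ ts → TieredF ts → All (ChildEdge rootVtx ∘ rootV) ts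
root-childEdges []                _                             = []
root-childEdges (node _ _ _ ∷ ts) ((1≤w , 1≤lv , _) , tiereds) =
  (inj₂ 1≤lv , inj₂ (1≤lv , 1≤w)) ∷ root-childEdges ts tiereds

NoNorthWest : Vtx → List Vtx → Set
NoNorthWest u = All (λ v → ¬ u ⊏ v)

root-noNorthWest : {vs : List Vtx} → All Positive vs → NoNorthWest rootVtx vs
root-noNorthWest = All.map (λ (0<w , _) ((w≤0 , _) , _) → <⇒≱ 0<w w≤0)

pre-⇝-later-sibling : ∀ t → NoInvT u t → NoNorthWest u (verts t) → rootV t ≺ z → z ⋈ u →
                      All (_⇝ z) (pre t)
pre-⇝-later-sibling t@(node _ _ _) (¬invs , _) (_ ∷ noNW) t≺z z⋈u =
  All-resp-↭ (↭-sym (pre-↭ t))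
    (≺⇒⇝ t≺z ∷ All.zipWith (uncurry (⇝-later-sibling z⋈u t≺z)) (¬invs , noNW))

-- The entry (rootV t , pre t) of preF for a child t of x.
record ChildBlock (x : Vtx) (e : Entry) : Set where
  constructor childBlock
  field
    rest          : List Vtx
    headed        : proj₂ e ≡ proj₁ e ∷ rest
    linked        : Linked _⇝_ (proj₂ e)
    edge          : ChildEdge x (proj₁ e)
    later-sibling : ∀ {z} → proj₁ e ≺ z → z ⋈ x → All (_⇝ z) (proj₂ e)

blocks-linked : ∀ es → All (ChildBlock x) es → Linked (_≺_ on proj₁) es →
                Linked _⇝_ (concat (map proj₂ es))
blocks-linked []       []       []  = []
blocks-linked (_ ∷ []) (b ∷ []) [-] = subst (Linked _⇝_) (sym (++-identityʳ _)) (ChildBlock.linked b)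
blocks-linked (_ ∷ e′ ∷ es) (b ∷ b′@(childBlock _ refl _ (_ , e′⋈x) _) ∷ bs) (e≺e′ ∷ sorted) =
  ++-∷⁺ (ChildBlock.linked b) (ChildBlock.later-sibling b e≺e′ e′⋈x)
    (blocks-linked (e′ ∷ es) (b′ ∷ bs) sorted)

children-linked : ∀ es → All (ChildBlock x) es → Linked (_≺_ on proj₁) es →
                  Linked _⇝_ (x ∷ concat (map proj₂ es))
children-linked [] _ _ = [-]
children-linked es@(_ ∷ _) bs@(childBlock _ refl _ (x⇝e , _) _ ∷ _) sorted =
  x⇝e ∷ blocks-linked es bs sorted

mutual
  preorder-linked : ∀ ts → AllPairs (_≢_ on rootV) ts → TieredF ts → All (ChildEdge x ∘ rootV) ts →
                    NoInvF x ts → NoNorthWest x (vertsF ts) → Linked _⇝_ (x ∷ order ts)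
  preorder-linked ts distinct tiered edges noInv noNW =
    children-linked (sortP (preF ts))
      (All-resp-↭ (↭-sym (sortP-↭ (preF ts))) (child-blocks ts tiered edges noInv noNW))
      (AllPairs⇒Linked (sortP-sorted (preF ts) (preF-distinct ts distinct)))

  child-blocks : ∀ ts → TieredF ts → All (ChildEdge x ∘ rootV) ts → NoInvF x ts →
                 NoNorthWest x (vertsF ts) → All (ChildBlock x) (preF ts)
  child-blocks []                     _ _ _ _ = []
  child-blocks (t@(node _ _ cs) ∷ ts) ((_ , _ , edges , distinct , tiered) , tiereds) (edge ∷ edges′)
               (noInvₜ@(¬invs , noInv) , noInvs) noNW =
    childBlock (order cs) refl
      (preorder-linked cs distinct tiered (All.map edge⇒childEdge edges) noInv
        (All.zipWith (uncurry (¬⊏-child (proj₂ edge))) (¬invs , All.tail noNWₜ)))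
      edge
      (pre-⇝-later-sibling t noInvₜ noNWₜ)
    ∷ child-blocks ts tiereds edges′ noInvs (Allₚ.++⁻ʳ (verts t) noNW)
    where noNWₜ = Allₚ.++⁻ˡ (verts t) noNW

order-linked : ∀ F → Tiered F → NoInvF rootVtx F → Linked _⇝_ (order F)
order-linked F (distinct , tiered) noInv =
  Linked.tail (preorder-linked F distinct tiered (root-childEdges F tiered) noInv
                 (root-noNorthWest (forest-positive F tiered)))

-- The map φ

levels : List Vtx → List ℕ
levels = map lv

maxLv-levels : ∀ vs → maxLv vs ≡ foldr _⊔_ 0 (levels vs)
maxLv-levels vs = sym (foldr-map _⊔_ lv 0 vs)

minLv-levels : ∀ vs → minLv vs ≡ foldr _⊓_ (maxLv vs) (levels vs)
minLv-levels vs = sym (foldr-map _⊓_ lv (maxLv vs) vs)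

levels-bounded : ∀ vs → All (InRange (minLv vs) (maxLv vs)) (levels vs)
levels-bounded vs = All.zip (lower , upper)
  where
  lower : All (minLv vs ≤_) (levels vs)
  lower rewrite minLv-levels vs = foldr-⊓-lower _ _
  upper : All (_≤ maxLv vs) (levels vs)
  upper rewrite maxLv-levels vs = foldr-⊔-upper _ _

maxLv-∈ : ∀ {vs} → k ∈ levels vs → maxLv vs ∈ levels vs
maxLv-∈ {vs = vs} k∈ rewrite maxLv-levels vs = foldr-⊔-∈ k∈

minLv-∈ : ∀ {vs} → k ∈ levels vs → minLv vs ∈ levels vs
minLv-∈ {vs = vs} k∈ rewrite minLv-levels vs = foldr-⊓-∈ (maxLv-∈ k∈)

reflect-positive : ∀ vs → All (λ v → 1 ≤ lv v) vs →
                   All (λ v → 1 ≤ reflect (minLv vs) (maxLv vs) (lv v)) vs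
reflect-positive []          _   = []
reflect-positive vs@(_ ∷ _) pos =
  All.map (λ b → ≤-trans 1≤min (proj₁ (reflect-inRange b))) (Allₚ.map⁻ (levels-bounded vs))
  where
  1≤min : 1 ≤ minLv vs
  1≤min = All.lookup (Allₚ.map⁺ pos) (minLv-∈ {vs = vs} (here refl))

reverse-order-↭ : ∀ F → reverse (order F) ↭ vertsF F
reverse-order-↭ F = ↭-trans (↭-reverse (order F)) (order-↭ F)

levels-order-↭ : ∀ F → levels (order F) ↭ levels (vertsF F)
levels-order-↭ F = ↭ₚ.map⁺ lv (order-↭ F)

vertex-levels-bounded : ∀ F → All (InRange (minLv (order F)) (maxLv (order F))) (levels (vertsF F))
vertex-levels-bounded F = All-resp-↭ (levels-order-↭ F) (levels-bounded (order F))

phi-ascents : ∀ F → Tiered F → NoInvF rootVtx F → ∀ i → 1 ≤ i → i < length (vertsF F) → Ascent (phi F) i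
phi-ascents F tiered noInv i 1≤i i<n =
  Linked⇒Ascent w (reflect l L ∘ lv) (reverse vs)
    (map-All reflect-step (All-resp-↭ (↭-sym (↭-reverse vs)) (Allₚ.map⁻ (All.map proj₂ (levels-bounded vs))))
      (reverse⁺ vs (order-linked F tiered noInv)))
    i 1≤i (subst (i <_) (sym (↭-length (reverse-order-↭ F))) i<n)
  where
  vs = order F
  L = maxLv vs
  l = minLv vs
  reflect-step : {x y : Vtx} → lv x ≤ L → y ⇝ x → w x < w y ⊎ reflect l L (lv x) < reflect l L (lv y)
  reflect-step lx≤L = Sum.map₂ (λ ly<lx → ∸-monoʳ-< ly<lx (≤-trans lx≤L (m≤m+n L l)))

phi-length : ∀ F → length (proj₁ (phi F)) ≡ length (vertsF F) × length (proj₂ (phi F)) ≡ length (vertsF F)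
phi-length F = trans (length-map w (reverse (order F))) len , trans (length-map _ (reverse (order F))) len
  where len = ↭-length (reverse-order-↭ F)

phi-labels-positive : ∀ F → All (λ v → 1 ≤ w v) (vertsF F) → All (1 ≤_) (proj₁ (phi F))
phi-labels-positive F pos = Allₚ.map⁺ (All-resp-↭ (↭-sym (reverse-order-↭ F)) pos)

phi-levels-positive : ∀ F → All (λ v → 1 ≤ lv v) (vertsF F) → All (1 ≤_) (proj₂ (phi F))
phi-levels-positive F pos =
  Allₚ.map⁺ (All-resp-↭ (↭-sym (↭-reverse (order F)))
    (reflect-positive (order F) (All-resp-↭ (↭-sym (order-↭ F)) pos)))

phi-α : ∀ F i → alphaS (phi F) i ≡ alphaT F i
phi-α F i = count-↭ i (↭ₚ.map⁺ w (reverse-order-↭ F))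

phi-β-extrema : ∀ F i → betaS (phi F) i ≡ revWith (minLv (order F)) (maxLv (order F)) (betaT F) i
phi-β-extrema F i = begin
  count i (map (reflect l L ∘ lv) (reverse vs))   ≡⟨ count-↭ i (↭ₚ.map⁺ _ (↭-reverse vs)) ⟩
  count i (map (reflect l L ∘ lv) vs)             ≡⟨ cong (count i) (map-∘ vs) ⟩
  count i (map (reflect l L) (levels vs))         ≡⟨ count-↭ i (↭ₚ.map⁺ _ (levels-order-↭ F)) ⟩
  count i (map (reflect l L) (levels (vertsF F))) ≡⟨ count-reflect _ (vertex-levels-bounded F) ⟩
  revWith l L (betaT F) i                         ∎
  where
  open ≡-Reasoning
  vs = order F
  L = maxLv vs
  l = minLv vs

minSupp≡minLv : ∀ F → All (λ v → 1 ≤ lv v) (vertsF F) → IsMinSupp (betaT F) s → s ≡ minLv (order F)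
minSupp≡minLv F pos minSupp@(_ , count-s≢0 , _) =
  minSupp≡least (All.lookup (Allₚ.map⁺ pos) min∈) min∈ (All.map proj₁ (vertex-levels-bounded F)) minSupp
  where
  perm = levels-order-↭ F
  min∈ = ∈-resp-↭ perm (minLv-∈ (∈-resp-↭ (↭-sym perm) (count≢0⇒∈ count-s≢0)))

maxSupp≡maxLv : ∀ F → IsMaxSupp (betaT F) m → m ≡ maxLv (order F)
maxSupp≡maxLv F maxSupp@(count-m≢0 , _) =
  maxSupp≡greatest max∈ (All.map proj₂ (vertex-levels-bounded F)) maxSupp
  where
  perm = levels-order-↭ F
  max∈ = ∈-resp-↭ perm (maxLv-∈ (∈-resp-↭ (↭-sym perm) (count≢0⇒∈ count-m≢0)))

phi-β : ∀ F → All (λ v → 1 ≤ lv v) (vertsF F) → IsMinSupp (betaT F) s → IsMaxSupp (betaT F) m →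
        ∀ i → betaS (phi F) i ≡ revWith s m (betaT F) i
phi-β F pos minSupp maxSupp i
  rewrite minSupp≡minLv F pos minSupp | maxSupp≡maxLv F maxSupp = phi-β-extrema F i

proposition4p7 : (n : ℕ) → 1 ≤ n → (T : RTree) → zRTT0 n T →
    (∀ i → 1 ≤ i → i ≤ n ∸ 1 → Ascent (phi T) i)
    × zLD2 n (phi T)
    × (∀ i → 1 ≤ i → alphaS (phi T) i ≡ alphaT T i)
    × (∀ s m → IsMinSupp (betaT T) s → IsMaxSupp (betaT T) m →
         ∀ i → 1 ≤ i → betaS (phi T) i ≡ revWith s m (betaT T) i)
proposition4p7 (suc n) (s≤s z≤n) T (size , tiered , noInv) =
  ascents ,
  (trans (proj₁ (phi-length T)) size , trans (proj₂ (phi-length T)) size ,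
   phi-labels-positive T (All.map proj₁ positive) , phi-levels-positive T (All.map proj₂ positive) ,
   ascents) ,
  (λ i _ → phi-α T i) ,
  (λ s m minSupp maxSupp i _ → phi-β T (All.map proj₂ positive) minSupp maxSupp i)
  where
  positive = forest-positive T (proj₂ tiered)
  ascents : ∀ i → 1 ≤ i → i ≤ n → Ascent (phi T) i
  ascents i 1≤i i≤n = phi-ascents T tiered noInv i 1≤i (subst (i <_) (sym size) (s≤s i≤n))
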